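{- Let $G$ be a circular permutation graph with $n$ vertices. Then $\mathrm{boolw}(G) \le 2\log_2 n$.
   Context: A graph is a circular permutation graph if it has an intersection model consisting of curves (one per vertex) between two distinct concentric circles, such that no two curves cross in more than one point and no two curves touch without crossing; vertices are adjacent iff their curves intersect. For $A\subseteq V(G)$ write $\overline{A}=V(G)\setminus A$. A decomposition tree of $G$ is a pair $(T,\delta)$ where $T$ is a tree whose internal nodes have degree three and which has $|V(G)|$ leaves, and $\delta$ is a bijection between $V(G)$ and the leaves of $T$; each edge of $T$ defines a cut $\{A,\overline{A}\}$ given by the leaves of the two components of $T$ minus that edge. Define $\mathrm{cut\text{ - }bool}(A)=\log_2|\{S\subseteq\overline{A} : \exists X\subseteq A,\ S=\overline{A}\cap\bigcup_{x\in X}N(x)\}|$. The boolean-width of $(T,\delta)$ is the maximum of $\mathrm{cut\text{ - }bool}(A)$ over cuts given by edges of $T$, and $\mathrm{boolw}(G)$ is the minimum over all decomposition trees of $G$. -}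

module Defs where

open import Data.Bool using (Bool; true; false; not; _∧_)
open import Data.Bool.Properties using () renaming (_≟_ to _≟B_)
open import Data.Nat as ℕ using (ℕ; suc)
open import Data.Fin using (Fin) renaming (_≟_ to _≟F_)
open import Relation.Nullary.Decidable using (⌊_⌋)
open import Data.Integer as ℤ using (ℤ; +_; _-_; _<_)
open import Data.Integer.Divisibility using (_∣_)
open import Data.List using (List; []; _∷_; _++_; map; length; allFin; deduplicate)
open import Data.Bool.ListAction using (any)
open import Data.List.Relation.Binary.Permutation.Propositional using (_↭_)
open import Data.Vec as V using (Vec; tabulate; lookup)
open import Data.Vec.Properties using (≡-dec)
open import Data.Product using (Σ; _×_; ∃; ∃-syntax)
open import Data.Sum using (_⊎_)
open import Relation.Nullary using (¬_)
open import Relation.Binary.PropositionalEquality using (_≡_)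

Graph : ℕ → Set
Graph n = Fin n → Fin n → Bool

IsSimple : ∀ {n} → Graph n → Set
IsSimple {n} E = (∀ u v → E u v ≡ E v u) × (∀ u → E u u ≡ false)

-- Circular permutation diagrams (combinatorial encoding of the annulus
-- model, via the universal cover strip).
-- Both circles are parametrised by ℤ modulo a period N > 0.  The curve of
-- vertex v goes from position a v on the outer circle to position b v on
-- the inner circle; b v is not reduced mod N, so it records the winding.
-- The lift of curve u and the k-th translate of the lift of curve v cross
-- iff their endpoint orders differ at the two circles.

Crosses : ∀ {n} (N : ℕ) (a b : Fin n → ℤ) → Fin n → Fin n → ℤ → Set
Crosses N a b u v k =
  ((a u - a v) < k ℤ.* + N × k ℤ.* + N < (b u - b v))
  ⊎ (k ℤ.* + N < (a u - a v) × (b u - b v) < k ℤ.* + N)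

record CircPermModel {n} (E : Graph n) : Set where
  field
    N : ℕ
    N-pos : 0 ℕ.< N
    a b : Fin n → ℤ
    a-distinct : ∀ u v → ¬ (u ≡ v) → ¬ ((+ N) ∣ (a u - a v))
    b-distinct : ∀ u v → ¬ (u ≡ v) → ¬ ((+ N) ∣ (b u - b v))
    at-most-once : ∀ u v k k′ → Crosses N a b u v k → Crosses N a b u v k′ → k ≡ k′
    adj-iff : ∀ u v → ¬ (u ≡ v) → (E u v ≡ true → ∃[ k ] Crosses N a b u v k)
                                 × (∃[ k ] Crosses N a b u v k → E u v ≡ true)

IsCircularPermutationGraph : ∀ {n} → Graph n → Set
IsCircularPermutationGraph E = IsSimple E × CircPermModel E

-- Decomposition trees, represented as full binary trees with leaves
-- labelled bijectively by the vertices (rooting the cubic tree on an edge).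

data BTree (n : ℕ) : Set where
  leaf : Fin n → BTree n
  node : BTree n → BTree n → BTree n

leaves : ∀ {n} → BTree n → List (Fin n)
leaves (leaf x)   = x ∷ []
leaves (node l r) = leaves l ++ leaves r

IsDecompositionTree : ∀ {n} → BTree n → Set
IsDecompositionTree {n} t = leaves t ↭ allFin n

-- proper subtrees (all nodes except the root); each edge of the unrooted
-- tree gives the cut {leaves s, complement} for some proper subtree s
data ProperSub {n} : BTree n → BTree n → Set where
  left  : ∀ {l r} → ProperSub (node l r) l
  right : ∀ {l r} → ProperSub (node l r) r
  inl   : ∀ {l r s} → ProperSub l s → ProperSub (node l r) s
  inr   : ∀ {l r s} → ProperSub r s → ProperSub (node l r) s

Subset : ℕ → Set
Subset n = Vec Bool n

allSubsets : ∀ n → List (Subset n)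
allSubsets ℕ.zero    = V.[] ∷ []
allSubsets (suc n) = map (true V.∷_) (allSubsets n) ++ map (false V.∷_) (allSubsets n)

fromList : ∀ {n} → List (Fin n) → Subset n
fromList xs = tabulate λ v → any (λ x → ⌊ x ≟F v ⌋) xs

-- Ā ∩ ⋃_{x ∈ X} N(x)   (X ∩ A is used, so X ranges over subsets of A)
unionNbr : ∀ {n} → Graph n → Subset n → Subset n → Subset n
unionNbr {n} E A X = tabulate λ v →
  not (lookup A v) ∧ any (λ x → lookup A x ∧ lookup X x ∧ E x v) (allFin n)

-- 2^{cut-bool(A)} = |{ Ā ∩ N(X) : X ⊆ A }|
cutBoolCount : ∀ {n} → Graph n → Subset n → ℕ
cutBoolCount {n} E A = length (deduplicate (≡-dec _≟B_) (map (unionNbr E A) (allSubsets n)))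

complement : ∀ {n} → Subset n → Subset n
complement = V.map not

-- boolean-width of the decomposition tree t is at most log₂ k
BoolwAtMostLog : ∀ {n} → Graph n → BTree n → ℕ → Set
BoolwAtMostLog E t k = ∀ s → ProperSub t s →
  (cutBoolCount E (fromList (leaves s)) ℕ.≤ k) × (cutBoolCount E (complement (fromList (leaves s))) ℕ.≤ k)

-- The model is read in the universal cover of the annulus: curve u runs from a u on the outer line
-- to b u on the inner line, and u, v are adjacent iff the lift of u crosses a translate of the lift
-- of v by some multiple of the period N.  Translating each curve by whole turns we may assume its
-- outer endpoint is the residue r u ∈ [0, N); its inner endpoint becomes β u.  Then for r u < r v
-- the vertices u, v are adjacent iff β v < β u or β u + N < β v (Model.adjacent⇔).
--
-- Sort the vertices by r and take the caterpillar with the leaves in this order.  Its cuts separate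
-- a single leaf from the rest, or a suffix (an upper arc of residues) from the prefix before it (a
-- lower arc).  Each side A of these cuts carries a key with "betweenness": a neighbour outside A
-- of y ∈ A is a neighbour of any x ∈ A below y or of any z ∈ A above y in key order.  The key is β
-- for arcs, arbitrary for a single vertex, and "adjacent to c" when the other side is {c}.  Under
-- betweenness Ā ∩ N(X) is determined by the key-least and key-greatest vertex of X ∩ A, so there are
-- at most n² such sets, i.e. cut-bool(A) ≤ 2 log₂ n, which is how the bound is stated (n * n).

module Submission where

open import Defs
open import Data.Bool using (Bool; true; false; not; _∧_; _∨_; T; if_then_else_)
open import Data.Bool.Properties using (T-∧; T-∨; ⇔→≡; T-≡) renaming (_≟_ to _≟B_)
open import Data.Bool.ListAction using (any)
open import Data.Empty using (⊥-elim)
open import Data.Fin using (Fin)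
open import Data.Fin.Properties using (any?)
open import Data.List using (List; []; _∷_; _++_; map; length; allFin; deduplicate; cartesianProduct)
open import Data.List.Properties using (length-++; length-map; length-tabulate)
open import Data.List.Membership.Propositional using (_∈_; _∉_; find; lose)
open import Data.List.Membership.Propositional.Properties
  using (∈-∃++; ∈-allFin; ∈-map⁺; ∈-map⁻; ∈-deduplicate⁻; ∈-cartesianProduct⁺; ∈-++⁺ʳ; ∈-++⁻)
open import Data.List.Relation.Unary.Any using (here; there)
open import Data.List.Relation.Unary.Any.Properties using (any⁺; any⁻)
import Data.List.Relation.Unary.All as All
open import Data.List.Relation.Unary.AllPairs using (AllPairs; []; _∷_)
open import Data.List.Relation.Unary.Unique.Propositional using (Unique)
open import Data.List.Relation.Unary.Unique.DecPropositional.Properties using (deduplicate-!)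
open import Data.Product using (Σ; _×_; _,_; ∃; ∃₂; proj₁; proj₂)
open import Data.Sum using (_⊎_; inj₁; inj₂; [_,_]′)
open import Data.Vec using (lookup; tabulate)
open import Data.Vec.Properties using (≡-dec; lookup∘tabulate; tabulate∘lookup; tabulate-cong; lookup-map)
open import Function using (_∘_; id)
open import Function.Bundles using (_⇔_; mk⇔; Equivalence)
open import Function.Construct.Composition using (_⇔-∘_)
open import Function.Construct.Symmetry using (⇔-sym)
open import Relation.Binary.PropositionalEquality
open import Relation.Nullary using (¬_; yes; no; Dec; ¬?; _×-dec_)
open import Relation.Nullary.Decidable using (toWitness; fromWitness; decidable-stable; T?; map′)

open Equivalence using (to; from)

-- Membership in a subset given by its characteristic vector.  It is a record rather than
-- T (lookup A x), so that the vertex and the subset can be inferred from a membership proof.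
infix 4 _∈ₛ_
record _∈ₛ_ {n} (x : Fin n) (A : Subset n) : Set where
  constructor in-subset
  field membership : T (lookup A x)
open _∈ₛ_

_∈ₛ?_ : ∀ {n} (x : Fin n) (A : Subset n) → Dec (x ∈ₛ A)
x ∈ₛ? A = map′ in-subset membership (T? (lookup A x))

T-injective : ∀ {a b} → T a ⇔ T b → a ≡ b
T-injective a⇔b = ⇔→≡ {z = true} (T-≡ ⇔-∘ (a⇔b ⇔-∘ ⇔-sym T-≡))

T-not : ∀ {b} → T (not b) ⇔ (¬ T b)
T-not {true}  = mk⇔ (λ ()) (λ ¬tt → ¬tt _)
T-not {false} = mk⇔ (λ _ ()) (λ _ → _)

T-any : ∀ {A : Set} {f : A → Bool} {xs} → T (any f xs) ⇔ (∃ λ x → x ∈ xs × T (f x))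
T-any {f = f} {xs} = mk⇔ (find ∘ any⁻ f xs) (λ (_ , x∈xs , fx) → any⁺ f (lose x∈xs fx))

subset-ext : ∀ {n} {A B : Subset n} → (∀ v → v ∈ₛ A ⇔ v ∈ₛ B) → A ≡ B
subset-ext {A = A} {B} same = begin
  A                   ≡⟨ tabulate∘lookup A ⟨
  tabulate (lookup A) ≡⟨ tabulate-cong (λ v → T-injective (unwrap (same v))) ⟩
  tabulate (lookup B) ≡⟨ tabulate∘lookup B ⟩
  B                   ∎
  where
  open ≡-Reasoning
  unwrap : ∀ {v} → v ∈ₛ A ⇔ v ∈ₛ B → T (lookup A v) ⇔ T (lookup B v)
  unwrap v∈A⇔v∈B = mk⇔ (membership ∘ to v∈A⇔v∈B ∘ in-subset) (membership ∘ from v∈A⇔v∈B ∘ in-subset)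

∉⇔T-not : ∀ {n} {A : Subset n} {v} → (¬ v ∈ₛ A) ⇔ T (not (lookup A v))
∉⇔T-not = mk⇔ (λ v∉A → from T-not (v∉A ∘ in-subset)) (λ v∉A v∈A → to T-not v∉A (membership v∈A))

∈-tabulate : ∀ {n} {f : Fin n → Bool} v → v ∈ₛ tabulate f ⇔ T (f v)
∈-tabulate {f = f} v = mk⇔ (subst T (lookup∘tabulate f v) ∘ membership) (in-subset ∘ subst T (sym (lookup∘tabulate f v)))

∈-fromList : ∀ {n} {xs : List (Fin n)} {v} → v ∈ₛ fromList xs ⇔ v ∈ xs
∈-fromList {xs = xs} {v} = mk⇔ listed (λ v∈xs → from (∈-tabulate v) (from T-any (v , v∈xs , fromWitness refl)))
  where
  listed : v ∈ₛ fromList xs → v ∈ xs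
  listed v∈A with to T-any (to (∈-tabulate v) v∈A)
  ... | x , x∈xs , x≟v = subst (_∈ xs) (toWitness x≟v) x∈xs

∈-complement : ∀ {n} {A : Subset n} {v} → v ∈ₛ complement A ⇔ (¬ v ∈ₛ A)
∈-complement {A = A} {v} = ⇔-sym ∉⇔T-not ⇔-∘ mk⇔ (subst T lookup-not ∘ membership) (in-subset ∘ subst T (sym lookup-not))
  where
  lookup-not : lookup (complement A) v ≡ not (lookup A v)
  lookup-not = lookup-map v not A

∉-complement : ∀ {n} {A : Subset n} {v} → ¬ v ∈ₛ complement A → v ∈ₛ A
∉-complement {A = A} {v} v∉Ā = decidable-stable (v ∈ₛ? A) (v∉Ā ∘ from ∈-complement)

∈-unionNbr : ∀ {n} {E : Graph n} {A X : Subset n} {v} →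
  v ∈ₛ unionNbr E A X ⇔ (¬ v ∈ₛ A × ∃ λ x → x ∈ₛ A × x ∈ₛ X × T (E x v))
∈-unionNbr {n} {E} {A} {X} {v} = mk⇔ into back ⇔-∘ ∈-tabulate v
  where
  Member : Set
  Member = ¬ v ∈ₛ A × ∃ λ x → x ∈ₛ A × x ∈ₛ X × T (E x v)
  term : Fin n → Bool
  term x = lookup A x ∧ lookup X x ∧ E x v
  into : T (not (lookup A v) ∧ any term (allFin n)) → Member
  into v∈U =
    let v∉A , some    = to T-∧ v∈U
        x , _ , x∈AXN = to (T-any {f = term} {allFin n}) some
        x∈A , x∈XN    = to T-∧ x∈AXN
        x∈X , xv      = to T-∧ x∈XN
    in from ∉⇔T-not v∉A , x , in-subset x∈A , in-subset x∈X , xv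
  back : Member → T (not (lookup A v) ∧ any term (allFin n))
  back (v∉A , x , x∈A , x∈X , xv) = from T-∧ (to ∉⇔T-not v∉A ,
    from (T-any {f = term} {allFin n}) (x , ∈-allFin x , from T-∧ (membership x∈A , from T-∧ (membership x∈X , xv))))

-- The candidate values of Ā ∩ N(X ∩ A): the neighbours outside A of two vertices p, q of A
-- (and the empty set when p ∉ A).
pairNbr : ∀ {n} → Graph n → Subset n → Fin n × Fin n → Subset n
pairNbr E A (p , q) = tabulate λ v → not (lookup A v) ∧ (lookup A p ∧ (E p v ∨ E q v))

∈-pairNbr : ∀ {n} {E : Graph n} {A : Subset n} {p q v} →
  v ∈ₛ pairNbr E A (p , q) ⇔ (¬ v ∈ₛ A × p ∈ₛ A × (T (E p v) ⊎ T (E q v)))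
∈-pairNbr {E = E} {A} {p} {q} {v} = mk⇔ into back ⇔-∘ ∈-tabulate v
  where
  Member : Set
  Member = ¬ v ∈ₛ A × p ∈ₛ A × (T (E p v) ⊎ T (E q v))
  into : T (not (lookup A v) ∧ (lookup A p ∧ (E p v ∨ E q v))) → Member
  into v∈P =
    let v∉A , rest = to T-∧ v∈P
        p∈A , pqv  = to T-∧ rest
    in from ∉⇔T-not v∉A , in-subset p∈A , to T-∨ pqv
  back : Member → T (not (lookup A v) ∧ (lookup A p ∧ (E p v ∨ E q v)))
  back (v∉A , p∈A , pqv) = from T-∧ (to ∉⇔T-not v∉A , from T-∧ (membership p∈A , from T-∨ pqv))

module Counting where
  open import Data.Nat using (suc; _+_; _*_; _≤_; z≤n; s≤s)
  open import Data.Nat.Properties using (+-suc; module ≤-Reasoning)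
  open import Data.List.Membership.Propositional.Properties using (∈-++⁺ˡ)

  unique-length-≤ : ∀ {A : Set} {xs ys : List A} → Unique xs → (∀ {x} → x ∈ xs → x ∈ ys) →
    length xs ≤ length ys
  unique-length-≤ {xs = []} _ _ = z≤n
  unique-length-≤ {xs = x ∷ xs} (x∉xs ∷ unique) xs⊆ys with ∈-∃++ (xs⊆ys (here refl))
  ... | ys₁ , ys₂ , refl = begin
    suc (length xs)                    ≤⟨ s≤s (unique-length-≤ unique rest⊆) ⟩
    suc (length (ys₁ ++ ys₂))          ≡⟨ cong suc (length-++ ys₁) ⟩
    suc (length ys₁ + length ys₂)      ≡⟨ +-suc (length ys₁) (length ys₂) ⟨
    length ys₁ + suc (length ys₂)      ≡⟨ length-++ ys₁ ⟨
    length (ys₁ ++ x ∷ ys₂)            ∎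
    where
    open ≤-Reasoning
    rest⊆ : ∀ {y} → y ∈ xs → y ∈ ys₁ ++ ys₂
    rest⊆ y∈xs with ∈-++⁻ ys₁ (xs⊆ys (there y∈xs))
    ... | inj₁ y∈ys₁         = ∈-++⁺ˡ y∈ys₁
    ... | inj₂ (here y≡x)    = ⊥-elim (All.lookup x∉xs y∈xs (sym y≡x))
    ... | inj₂ (there y∈ys₂) = ∈-++⁺ʳ ys₁ y∈ys₂

  length-cartesianProduct : ∀ {A B : Set} (xs : List A) (ys : List B) →
    length (cartesianProduct xs ys) ≡ length xs * length ys
  length-cartesianProduct []       ys = refl
  length-cartesianProduct (x ∷ xs) ys = begin
    length (map (x ,_) ys ++ cartesianProduct xs ys)          ≡⟨ length-++ (map (x ,_) ys) ⟩
    length (map (x ,_) ys) + length (cartesianProduct xs ys)  ≡⟨ cong₂ _+_ (length-map (x ,_) ys) (length-cartesianProduct xs ys) ⟩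
    length ys + length xs * length ys                         ∎
    where open ≡-Reasoning

  cutBoolCount-≤ : ∀ {n} (E : Graph n) (A : Subset n) (h : Fin n × Fin n → Subset n) →
    (∀ X → ∃ λ pq → unionNbr E A X ≡ h pq) → cutBoolCount E A ≤ n * n
  cutBoolCount-≤ {n} E A h covered = begin
    cutBoolCount E A                      ≤⟨ unique-length-≤ (deduplicate-! (≡-dec _≟B_) values) inImage ⟩
    length (map h pairs)                  ≡⟨ length-map h pairs ⟩
    length pairs                          ≡⟨ length-cartesianProduct (allFin n) (allFin n) ⟩
    length (allFin n) * length (allFin n) ≡⟨ cong₂ _*_ (length-tabulate {n = n} id) (length-tabulate {n = n} id) ⟩
    n * n                                 ∎
    where
    open ≤-Reasoning
    values : List (Subset n)
    values = map (unionNbr E A) (allSubsets n)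
    pairs : List (Fin n × Fin n)
    pairs = cartesianProduct (allFin n) (allFin n)
    inImage : ∀ {S} → S ∈ deduplicate (≡-dec _≟B_) values → S ∈ map h pairs
    inImage S∈ with ∈-map⁻ (unionNbr E A) (∈-deduplicate⁻ (≡-dec _≟B_) values S∈)
    ... | X , _ , refl with covered X
    ...   | (p , q) , eq rewrite eq = ∈-map⁺ h (∈-cartesianProduct⁺ (∈-allFin p) (∈-allFin q))

module Betweenness where
  import Data.Nat as ℕ
  open import Data.Integer using (ℤ; 0ℤ; 1ℤ; -_; _≤_; _≤?_; +≤+)
  open import Data.Integer.Properties using (≤-refl; ≤-trans; <⇒≤; ≰⇒>; neg-cancel-≤)
  open import Relation.Unary using (Decidable)

  Betweenness : ∀ {n} → Graph n → Subset n → (Fin n → ℤ) → Set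
  Betweenness E A key = ∀ {x y z v} → x ∈ₛ A → y ∈ₛ A → z ∈ₛ A → ¬ v ∈ₛ A →
    key x ≤ key y → key y ≤ key z → T (E y v) → T (E x v) ⊎ T (E z v)

  least : ∀ {V : Set} {P : V → Set} (key : V → ℤ) → Decidable P → ∀ ws →
    (∀ {w} → w ∈ ws → ¬ P w) ⊎ ∃ λ p → P p × (∀ {w} → w ∈ ws → P w → key p ≤ key w)
  least key P? [] = inj₁ λ ()
  least key P? (w ∷ ws) with P? w | least key P? ws
  ... | no ¬Pw | inj₁ none          = inj₁ λ { (here refl) → ¬Pw ; (there u∈ws) → none u∈ws }
  ... | no ¬Pw | inj₂ (p , Pp , p≤) = inj₂ (p , Pp , λ { (here refl) Pw → ⊥-elim (¬Pw Pw) ; (there u∈ws) → p≤ u∈ws })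
  ... | yes Pw | inj₁ none          = inj₂ (w , Pw , λ { (here refl) _ → ≤-refl ; (there u∈ws) Pu → ⊥-elim (none u∈ws Pu) })
  ... | yes Pw | inj₂ (p , Pp , p≤) with key w ≤? key p
  ...   | yes w≤p = inj₂ (w , Pw , λ { (here refl) _ → ≤-refl ; (there u∈ws) Pu → ≤-trans w≤p (p≤ u∈ws Pu) })
  ...   | no  w≰p = inj₂ (p , Pp , λ { (here refl) _ → <⇒≤ (≰⇒> w≰p) ; (there u∈ws) → p≤ u∈ws })

  extremes : ∀ {V : Set} {P : V → Set} (key : V → ℤ) → Decidable P → ∀ ws →
    (∀ {w} → w ∈ ws → ¬ P w) ⊎
    ∃₂ λ p q → P p × P q × (∀ {w} → w ∈ ws → P w → key p ≤ key w × key w ≤ key q)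
  extremes key P? ws with least key P? ws | least (-_ ∘ key) P? ws
  ... | inj₁ none | _         = inj₁ none
  ... | inj₂ _    | inj₁ none = inj₁ none
  ... | inj₂ (p , Pp , p≤) | inj₂ (q , Pq , -q≤) =
    inj₂ (p , q , Pp , Pq , λ w∈ws Pw → p≤ w∈ws Pw , neg-cancel-≤ (-q≤ w∈ws Pw))

  unionNbr-empty : ∀ {n} {E : Graph n} {A X S : Subset n} →
    (∀ x → ¬ (x ∈ₛ A × x ∈ₛ X)) → (∀ v → ¬ v ∈ₛ S) → unionNbr E A X ≡ S
  unionNbr-empty {E = E} noneAX noneS = subset-ext λ v → mk⇔
    (λ v∈U → let _ , x , x∈A , x∈X , _ = to (∈-unionNbr {E = E}) v∈U in ⊥-elim (noneAX x (x∈A , x∈X)))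
    (λ v∈S → ⊥-elim (noneS v v∈S))

  -- Under betweenness, Ā ∩ N(X ∩ A) consists of the neighbours outside A of the key-least and the
  -- key-greatest vertex of X ∩ A.  The vertex c serves as a dummy index when X ∩ A and Ā are empty.
  unionNbr-covered : ∀ {n} {E : Graph n} {A : Subset n} {key : Fin n → ℤ} → Fin n →
    Betweenness E A key → ∀ X → ∃ λ pq → unionNbr E A X ≡ pairNbr E A pq
  unionNbr-covered {n} {E} {A} {key} c between X
    with extremes key (λ x → x ∈ₛ? A ×-dec x ∈ₛ? X) (allFin n)
  ... | inj₂ (p , q , (p∈A , p∈X) , (q∈A , q∈X) , extreme) =
    (p , q) , subset-ext λ v →
      ⇔-sym (∈-pairNbr {E = E} {q = q}) ⇔-∘ (mk⇔ into back ⇔-∘ ∈-unionNbr)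
    where
    into : ∀ {v} → (¬ v ∈ₛ A × ∃ λ x → x ∈ₛ A × x ∈ₛ X × T (E x v)) →
           (¬ v ∈ₛ A × p ∈ₛ A × (T (E p v) ⊎ T (E q v)))
    into (v∉A , x , x∈A , x∈X , xv) =
      let p≤x , x≤q = extreme (∈-allFin x) (x∈A , x∈X)
      in v∉A , p∈A , between p∈A x∈A q∈A v∉A p≤x x≤q xv
    back : ∀ {v} → (¬ v ∈ₛ A × p ∈ₛ A × (T (E p v) ⊎ T (E q v))) →
           (¬ v ∈ₛ A × ∃ λ x → x ∈ₛ A × x ∈ₛ X × T (E x v))
    back (v∉A , _ , pqv) = v∉A , [ (λ pv → p , p∈A , p∈X , pv) , (λ qv → q , q∈A , q∈X , qv) ]′ pqv
  ... | inj₁ none with any? (λ u → ¬? (u ∈ₛ? A))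
  ...   | yes (w , w∉A) = (w , w) , unionNbr-empty (λ x → none (∈-allFin x))
                                      (λ v v∈P → w∉A (proj₁ (proj₂ (to (∈-pairNbr {E = E} {q = w}) v∈P))))
  ...   | no  all∈A     = (c , c) , unionNbr-empty (λ x → none (∈-allFin x))
                                      (λ v v∈P → all∈A (v , proj₁ (to (∈-pairNbr {E = E} {q = c}) v∈P)))

  betweenness-bound : ∀ {n} {E : Graph n} {A : Subset n} {key : Fin n → ℤ} → Fin n →
    Betweenness E A key → cutBoolCount E A ℕ.≤ n ℕ.* n
  betweenness-bound {E = E} {A} c between = Counting.cutBoolCount-≤ E A (pairNbr E A) (unionNbr-covered c between)

  singleton-betweenness : ∀ {n} {E : Graph n} {A : Subset n} {c} (key : Fin n → ℤ) →
    (∀ {x} → x ∈ₛ A → x ≡ c) → Betweenness E A key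
  singleton-betweenness key only x∈A y∈A _ _ _ _ yv with only x∈A | only y∈A
  ... | refl | refl = inj₁ yv

  adjacencyKey : ∀ {n} → Graph n → Fin n → Fin n → ℤ
  adjacencyKey E c y = if E y c then 1ℤ else 0ℤ

  cosingleton-betweenness : ∀ {n} {E : Graph n} {A : Subset n} {c} →
    (∀ {v} → ¬ v ∈ₛ A → v ≡ c) → Betweenness E A (adjacencyKey E c)
  cosingleton-betweenness {E = E} only {y = y} {z} {v} _ _ _ v∉A _ y≤z yv with only v∉A
  ... | refl = inj₂ (upward (E y v) (E z v) yv y≤z)
    where
    upward : ∀ a b → T a → (if a then 1ℤ else 0ℤ) ≤ (if b then 1ℤ else 0ℤ) → T b
    upward true  true  _ _        = _
    upward true  false _ (+≤+ ())

  threshold-betweenness : ∀ {n} {E : Graph n} {A : Subset n} {key : Fin n → ℤ}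
    (Below Above : Fin n → ℤ → Set) →
    (∀ {v i j} → i ≤ j → Below v j → Below v i) →
    (∀ {v i j} → i ≤ j → Above v i → Above v j) →
    (∀ {y v} → y ∈ₛ A → ¬ v ∈ₛ A → T (E y v) ⇔ (Below v (key y) ⊎ Above v (key y))) →
    Betweenness E A key
  threshold-betweenness Below Above down up nbr x∈A y∈A z∈A v∉A x≤y y≤z yv
    with to (nbr y∈A v∉A) yv
  ... | inj₁ below = inj₁ (from (nbr x∈A v∉A) (inj₁ (down x≤y below)))
  ... | inj₂ above = inj₂ (from (nbr z∈A v∉A) (inj₂ (up y≤z above)))

module Strip where
  open import Data.Nat as ℕ using (z≤n)
  open import Data.Integer using (ℤ; +_; 0ℤ; -1ℤ; _+_; _-_; -_; _*_; _<_; _≤_; +<+; +≤+)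
  open import Data.Integer.Properties
  open import Data.Integer.Tactic.RingSolver using (solve-∀)

  -- In the universal cover of the annulus, two
  -- curves cross iff the difference t of their outer endpoints and their inner endpoints lie on
  -- opposite sides: Crosses N a b u v k unfolds to Separates (a u - a v) (b u - b v) (k * N).
  Separates : ℤ → ℤ → ℤ → Set
  Separates d e t = (d < t × t < e) ⊎ (t < d × e < t)

  separates-≡ : ∀ {d d′ e e′ t t′} → d ≡ d′ → e ≡ e′ → t ≡ t′ → Separates d e t → Separates d′ e′ t′
  separates-≡ refl refl refl s = s

  separates-translate : ∀ {d e t} c → Separates d e t → Separates (d + c) (e + c) (t + c)
  separates-translate c (inj₁ (d<t , t<e)) = inj₁ (+-monoˡ-< c d<t , +-monoˡ-< c t<e)
  separates-translate c (inj₂ (t<d , e<t)) = inj₂ (+-monoˡ-< c t<d , +-monoˡ-< c e<t)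

  separates-untranslate : ∀ {d e t} c → Separates (d + c) (e + c) (t + c) → Separates d e t
  separates-untranslate {d} {e} {t} c =
    separates-≡ (cancel d c) (cancel e c) (cancel t c) ∘ separates-translate (- c)
    where
    cancel : ∀ x c → x + c + - c ≡ x
    cancel = solve-∀

  multiple-separates⇔ : ∀ N {d e} → - + N < d → d < 0ℤ →
    (∃ λ k → Separates d e (k * + N)) ⇔ (0ℤ < e ⊎ e < - + N)
  multiple-separates⇔ N {d} {e} -N<d d<0 = mk⇔ into back
    where
    -1*N : -1ℤ * + N ≡ - + N
    -1*N = -1*i≡-i (+ N)
    into : (∃ λ k → Separates d e (k * + N)) → 0ℤ < e ⊎ e < - + N
    into (k , inj₁ (d<kN , kN<e)) = inj₁ (≤-<-trans (*-monoʳ-≤-nonNeg (+ N) (i<j⇒suc[i]≤j -1<k)) kN<e)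
      where
      -- -N < d < kN forces k ≥ 0, so kN ≥ 0
      -1<k : -1ℤ < k
      -1<k = *-cancelʳ-<-nonNeg (+ N) (subst (_< k * + N) (sym -1*N) (<-trans -N<d d<kN))
    into (k , inj₂ (kN<d , e<kN)) =
      inj₂ (<-≤-trans e<kN (subst (k * + N ≤_) -1*N (*-monoʳ-≤-nonNeg (+ N) (i<j⇒i≤pred[j] k<0))))
      where
      -- kN < d < 0 forces k ≤ -1, so kN ≤ -N
      k<0 : k < 0ℤ
      k<0 = *-cancelʳ-<-nonNeg (+ N) (<-trans kN<d d<0)
    back : 0ℤ < e ⊎ e < - + N → ∃ λ k → Separates d e (k * + N)
    back (inj₁ 0<e)  = 0ℤ , inj₁ (d<0 , 0<e)
    back (inj₂ e<-N) = -1ℤ , inj₂ (subst (_< d) (sym -1*N) -N<d , subst (e <_) (sym -1*N) e<-N)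

  residue-difference : ∀ {m n N} → m ℕ.< n → n ℕ.< N → - + N < + m - + n × + m - + n < 0ℤ
  residue-difference {m} {n} {N} m<n n<N =
      subst (_< + m - + n) (+-identityˡ (- + N)) (+-mono-≤-< (+≤+ z≤n) (neg-mono-< (+<+ n<N)))
    , subst (+ m - + n <_) (+-inverseʳ (+ n)) (+-monoˡ-< (- + n) (+<+ m<n))

-- The combinatorics of a circular permutation model: outer endpoints are reduced modulo N to
-- residues r, and each curve is translated by the same number of turns so that its outer endpoint
-- lands in [0, N); β is the correspondingly translated inner endpoint.
module Model {n} {E : Graph n} (M : CircPermModel E) where
  open import Data.Nat as ℕ using (ℕ; >-nonZero; NonZero)
  import Data.Nat.Properties as ℕP
  open import Data.Integer using (ℤ; +_; 0ℤ; _+_; _-_; -_; _*_; _<_)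
  open import Data.Integer.Properties
  open import Data.Integer.DivMod using (_%ℕ_; _/ℕ_; a≡a%ℕn+[a/ℕn]*n; n%ℕd<d)
  open import Data.Integer.Divisibility.Signed using (_∣_; ∣⇒∣ᵤ; ∣n⇒∣m*n; ∣-refl)
  open import Data.Integer.Tactic.RingSolver using (solve-∀)
  open import Data.Sum using (swap)
  open CircPermModel M
  open Strip
  open Betweenness

  instance
    N-nonZero : NonZero N
    N-nonZero = >-nonZero N-pos

  r : Fin n → ℕ
  r u = a u %ℕ N

  turns : Fin n → ℤ
  turns u = a u /ℕ N

  β : Fin n → ℤ
  β u = b u - turns u * + N

  r<N : ∀ u → r u ℕ.< N
  r<N u = n%ℕd<d (a u) N

  outer-difference : ∀ u v → a u - a v ≡ (+ r u - + r v) + (turns u - turns v) * + N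
  outer-difference u v = begin
    a u - a v                                           ≡⟨ cong₂ _-_ (a≡a%ℕn+[a/ℕn]*n (a u) N) (a≡a%ℕn+[a/ℕn]*n (a v) N) ⟩
    (+ r u + turns u * + N) - (+ r v + turns v * + N)   ≡⟨ regroup (+ r u) (+ r v) (turns u) (turns v) (+ N) ⟩
    (+ r u - + r v) + (turns u - turns v) * + N         ∎
    where
    open ≡-Reasoning
    regroup : ∀ x y s t m → (x + s * m) - (y + t * m) ≡ (x - y) + (s - t) * m
    regroup = solve-∀

  inner-difference : ∀ u v → b u - b v ≡ (β u - β v) + (turns u - turns v) * + N
  inner-difference u v = regroup (b u) (b v) (turns u) (turns v) (+ N)
    where
    regroup : ∀ x y s t m → x - y ≡ ((x - s * m) - (y - t * m)) + (s - t) * m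
    regroup = solve-∀

  crossing⇔ : ∀ u v → (∃ λ k → Crosses N a b u v k) ⇔ (∃ λ k → Separates (+ r u - + r v) (β u - β v) (k * + N))
  crossing⇔ u v = mk⇔ into back
    where
    w : ℤ
    w = turns u - turns v
    into : (∃ λ k → Crosses N a b u v k) → ∃ λ k → Separates (+ r u - + r v) (β u - β v) (k * + N)
    into (k , cross) = k - w , separates-untranslate (w * + N)
      (separates-≡ (outer-difference u v) (inner-difference u v) (regroup k w (+ N)) cross)
      where
      regroup : ∀ k w m → k * m ≡ (k - w) * m + w * m
      regroup = solve-∀
    back : (∃ λ k → Separates (+ r u - + r v) (β u - β v) (k * + N)) → ∃ λ k → Crosses N a b u v k
    back (k , sep) = k + w , separates-≡ (sym (outer-difference u v)) (sym (inner-difference u v))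
      (sym (*-distribʳ-+ (+ N) k w)) (separates-translate (w * + N) sep)

  adjacent⇔ : ∀ {u v} → r u ℕ.< r v → T (E u v) ⇔ (0ℤ < β u - β v ⊎ β u - β v < - + N)
  adjacent⇔ {u} {v} ru<rv =
    multiple-separates⇔ N -N<δ δ<0 ⇔-∘ (crossing⇔ u v ⇔-∘ (mk⇔ (proj₁ (adj-iff u v u≢v)) (proj₂ (adj-iff u v u≢v)) ⇔-∘ T-≡))
    where
    u≢v : ¬ u ≡ v
    u≢v refl = ℕP.<-irrefl refl ru<rv
    -N<δ : - + N < + r u - + r v
    -N<δ = proj₁ (residue-difference ru<rv (r<N v))
    δ<0 : + r u - + r v < 0ℤ
    δ<0 = proj₂ (residue-difference ru<rv (r<N v))

  r-injective : ∀ {u v} → ¬ u ≡ v → ¬ r u ≡ r v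
  r-injective {u} {v} u≢v ru≡rv = a-distinct u v u≢v (∣⇒∣ᵤ (subst (+ N ∣_) (sym whole-turns) (∣n⇒∣m*n w ∣-refl)))
    where
    w : ℤ
    w = turns u - turns v
    whole-turns : a u - a v ≡ w * + N
    whole-turns = begin
      a u - a v                    ≡⟨ outer-difference u v ⟩
      (+ r u - + r v) + w * + N    ≡⟨ cong (λ m → (+ m - + r v) + w * + N) ru≡rv ⟩
      (+ r v - + r v) + w * + N    ≡⟨ cong (_+ w * + N) (+-inverseʳ (+ r v)) ⟩
      0ℤ + w * + N                 ≡⟨ +-identityˡ (w * + N) ⟩
      w * + N                      ∎
      where open ≡-Reasoning

  LowerArc UpperArc : Subset n → Set
  LowerArc A = ∀ {x v} → x ∈ₛ A → ¬ v ∈ₛ A → r x ℕ.< r v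
  UpperArc A = ∀ {x v} → x ∈ₛ A → ¬ v ∈ₛ A → r v ℕ.< r x

  lowerArc-betweenness : ∀ {A} → LowerArc A → Betweenness E A β
  lowerArc-betweenness arc = threshold-betweenness
    (λ v i → i - β v < - + N) (λ v i → 0ℤ < i - β v)
    (λ {v} i≤j → ≤-<-trans (+-monoˡ-≤ (- β v) i≤j))
    (λ {v} i≤j 0<i-βv → <-≤-trans 0<i-βv (+-monoˡ-≤ (- β v) i≤j))
    (λ y∈A v∉A → mk⇔ swap swap ⇔-∘ adjacent⇔ (arc y∈A v∉A))

  upperArc-betweenness : (∀ u v → E u v ≡ E v u) → ∀ {A} → UpperArc A → Betweenness E A β
  upperArc-betweenness symmetric arc = threshold-betweenness
    (λ v i → 0ℤ < β v - i) (λ v i → β v - i < - + N)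
    (λ {v} i≤j 0<βv-j → <-≤-trans 0<βv-j (+-monoʳ-≤ (β v) (neg-mono-≤ i≤j)))
    (λ {v} i≤j → ≤-<-trans (+-monoʳ-≤ (β v) (neg-mono-≤ i≤j)))
    (λ {y} {v} y∈A v∉A → adjacent⇔ (arc y∈A v∉A) ⇔-∘ mk⇔ (subst T (symmetric y v)) (subst T (symmetric v y)))

module Caterpillar where
  open import Data.Nat as ℕ using (ℕ; _≤_; _<_)
  import Data.Nat.Properties as ℕP
  import Relation.Binary.Construct.On as On
  import Data.List.Sort as Sort
  open import Level using (0ℓ)
  open import Relation.Binary.Bundles using (DecTotalOrder)
  open import Data.List.Relation.Unary.Sorted.TotalOrder.Properties using (Sorted⇒AllPairs)
  open import Data.List.Relation.Binary.Permutation.Propositional using (_↭_)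

  sort-by : ∀ {A : Set} (key : A → ℕ) (xs : List A) → ∃ λ ys → ys ↭ xs × AllPairs (λ u v → key u ≤ key v) ys
  sort-by key xs = sort xs , sort-↭ xs , Sorted⇒AllPairs (DecTotalOrder.totalOrder byKey) (sort-↗ xs)
    where
    byKey : DecTotalOrder 0ℓ 0ℓ 0ℓ
    byKey = On.decTotalOrder ℕP.≤-decTotalOrder key
    open Sort byKey using (sort; sort-↭; sort-↗)

  allPairs-across : ∀ {A : Set} {R : A → A → Set} {x y : A} (xs : List A) {ys} →
    AllPairs R (xs ++ ys) → x ∈ xs → y ∈ ys → R x y
  allPairs-across (x ∷ xs) (x≺ ∷ _) (here refl) y∈ys = All.lookup x≺ (∈-++⁺ʳ xs y∈ys)
  allPairs-across (_ ∷ xs) (_ ∷ pairs) (there x∈xs) y∈ys = allPairs-across xs pairs x∈xs y∈ys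

  caterpillar : ∀ {n} → Fin n → List (Fin n) → BTree n
  caterpillar x []       = leaf x
  caterpillar x (y ∷ ys) = node (leaf x) (caterpillar y ys)

  leaves-caterpillar : ∀ {n} (x : Fin n) xs → leaves (caterpillar x xs) ≡ x ∷ xs
  leaves-caterpillar x []       = refl
  leaves-caterpillar x (y ∷ ys) = cong (x ∷_) (leaves-caterpillar y ys)

  caterpillar-subtree : ∀ {n} {x : Fin n} {xs s} → ProperSub (caterpillar x xs) s →
    (∃ λ c → s ≡ leaf c) ⊎ (∃₂ λ pre z → ∃ λ zs → x ∷ xs ≡ pre ++ z ∷ zs × s ≡ caterpillar z zs)
  caterpillar-subtree {xs = []} ()
  caterpillar-subtree {x = x} {y ∷ ys} left  = inj₁ (x , refl)
  caterpillar-subtree {x = x} {y ∷ ys} right = inj₂ (x ∷ [] , y , ys , refl , refl)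
  caterpillar-subtree {xs = y ∷ ys} (inl ())
  caterpillar-subtree {x = x} {y ∷ ys} (inr sub) with caterpillar-subtree {x = y} {ys} sub
  ... | inj₁ isLeaf = inj₁ isLeaf
  ... | inj₂ (pre , z , zs , split , refl) = inj₂ (x ∷ pre , z , zs , cong (x ∷_) split , refl)

  CutBound : ∀ {n} → Graph n → Subset n → Set
  CutBound {n} E A = cutBoolCount E A ≤ n ℕ.* n × cutBoolCount E (complement A) ≤ n ℕ.* n

  -- For a circular permutation graph, the caterpillar whose leaves are all vertices in order of
  -- increasing residue has every cut bounded by n²: leaf cuts by (co)singleton betweenness,
  -- suffix cuts because a suffix is an upper arc and its complement a lower arc.
  module _ {n} {E : Graph n} (simple : IsSimple E) (M : CircPermModel E) where
    open Model M
    open Betweenness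
    open import Data.Integer using (0ℤ)

    leaf-cut : ∀ c → CutBound E (fromList (c ∷ []))
    leaf-cut c = betweenness-bound {E = E} c (singleton-betweenness {E = E} (λ _ → 0ℤ) only)
               , betweenness-bound {E = E} c (cosingleton-betweenness {E = E} (only ∘ ∉-complement))
      where
      A : Subset n
      A = fromList (c ∷ [])
      only : ∀ {x} → x ∈ₛ A → x ≡ c
      only x∈A with to (∈-fromList {xs = c ∷ []}) x∈A
      ... | here x≡c = x≡c

    suffix-cut : ∀ {S} (c : Fin n) → (∀ {w u} → w ∉ S → u ∈ S → r w < r u) → CutBound E (fromList S)
    suffix-cut {S} c below = betweenness-bound {E = E} c (upperArc-betweenness (proj₁ simple) upper)
                           , betweenness-bound {E = E} c (lowerArc-betweenness lower)
      where
      A : Subset n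
      A = fromList S
      upper : UpperArc A
      upper x∈A v∉A = below (v∉A ∘ from ∈-fromList) (to ∈-fromList x∈A)
      lower : LowerArc (complement A)
      lower x∈Ā v∉Ā = below (to ∈-complement x∈Ā ∘ from ∈-fromList) (to ∈-fromList (∉-complement v∉Ā))

    suffix-below : ∀ {pre S} → (∀ v → v ∈ pre ++ S) → AllPairs (λ u v → r u ≤ r v) (pre ++ S) →
      ∀ {w u} → w ∉ S → u ∈ S → r w < r u
    suffix-below {pre} complete sorted {w} w∉S u∈S with ∈-++⁻ pre (complete w)
    ... | inj₁ w∈pre = ℕP.≤∧≢⇒< (allPairs-across pre sorted w∈pre u∈S) (r-injective λ { refl → w∉S u∈S })
    ... | inj₂ w∈S   = ⊥-elim (w∉S w∈S)

    caterpillar-bound : ∀ {x xs} → (∀ v → v ∈ x ∷ xs) → AllPairs (λ u v → r u ≤ r v) (x ∷ xs) →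
      BoolwAtMostLog E (caterpillar x xs) (n ℕ.* n)
    caterpillar-bound {x} complete sorted s sub with caterpillar-subtree sub
    ... | inj₁ (c , refl) = leaf-cut c
    ... | inj₂ (pre , z , zs , split , refl) rewrite leaves-caterpillar z zs | split =
      suffix-cut x (suffix-below complete sorted)

open Caterpillar using (sort-by; caterpillar; leaves-caterpillar; caterpillar-bound)
open import Data.Nat using (ℕ; _*_; _≤_)
open import Data.Fin using (fromℕ<)
open import Data.List.Relation.Binary.Permutation.Propositional using (_↭_; ↭-sym)
open import Data.List.Relation.Binary.Permutation.Propositional.Properties using (∈-resp-↭)

mainTheorem2 : (n : ℕ) → 1 ≤ n → (E : Graph n) → IsCircularPermutationGraph E →
    Σ (BTree n) (λ t → IsDecompositionTree t × BoolwAtMostLog E t (n * n))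
mainTheorem2 n 1≤n E (simple , M) with sort-by (Model.r M) (allFin n)
... | [] , sorted↭ , _ = ⊥-elim (noVertex (∈-resp-↭ (↭-sym sorted↭) (∈-allFin (fromℕ< 1≤n))))
  where
  noVertex : ∀ {v : Fin n} → v ∉ []
  noVertex ()
... | x ∷ xs , sorted↭ , sorted =
    caterpillar x xs
  , subst (_↭ allFin n) (sym (leaves-caterpillar x xs)) sorted↭
  , caterpillar-bound simple M (λ v → ∈-resp-↭ (↭-sym sorted↭) (∈-allFin v)) sorted
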